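{- For every odd prime $p$, \[ 12-9\binom{2p}{p}+2\binom{3p}{p}\equiv 24p^3\sum_{n=1}^{p-1}\frac{1}{n^3}\pmod{p^6}. \]
   Context: For rational numbers $x,y$ and a positive integer $m$, $x\equiv y\pmod m$ means that the numerator of $x-y$ (in lowest terms) is divisible by $m$. -}

module Defs where

open import Data.Nat as ℕ using (ℕ; zero; suc)
open import Data.Nat.Properties using (m^n≢0)
open import Data.Integer as ℤ using (ℤ; +_)
open import Data.Integer.Divisibility as ℤD using ()
open import Data.Rational as ℚ using (ℚ; ↥_)

-- x ≡ y (mod m) for rationals: the numerator of x - y (in lowest terms,
-- which is how Data.Rational.ℚ is represented) is divisible by m.
_≡_[modℚ_] : ℚ → ℚ → ℕ → Set
x ≡ y [modℚ m ] = (+ m) ℤD.∣ (↥ (x ℚ.- y))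

invCubeSuc : ℕ → ℚ
invCubeSuc k = (+ 1) ℚ./ (suc k ℕ.^ 3)
  where instance
    nz : ℕ.NonZero (suc k ℕ.^ 3)
    nz = m^n≢0 (suc k) 3

sumInvCube : ℕ → ℚ
sumInvCube zero = ℚ.0ℚ
sumInvCube (suc N) = sumInvCube N ℚ.+ invCubeSuc N

ℕ→ℚ : ℕ → ℚ
ℕ→ℚ n = (+ n) ℚ./ 1

module Submission where

-- Write p = 2h + 1 and z i = 1/((i + 1)(p - i - 1)) for i < h.  Pairing t with p - t in
-- C(mp + p, p) = ∏_{t=1}^{p} (mp + t)/t gives C(mp + p, p) = (m + 1) ∏_{i<h} (1 + m(m + 1)p² z i),
-- which is ≡ (m + 1)(1 + m(m + 1)p² e₁ + m²(m + 1)²p⁴ e₂) mod p⁶ for the elementary symmetric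
-- functions e₁, e₂ of the z i.  The same pairing gives Σ_{n=1}^{p-1} 1/n³ = p³ Σ z³ - 3p Σ z².
-- In 12 - 9 C(2p, p) + 2 C(3p, p) the constant and p² e₁ terms cancel, leaving
-- 144 p⁴ e₂ = 72 p⁴ (e₁² - Σ z²), so the two sides differ by 72 p⁴ e₁² mod p⁶.  Finally
-- e₁ ≡ 0 mod p, which follows from Σ_{i<h} 1/(i + 1)² ≡ 0 mod p and needs p ≥ 5.

open import Defs
open import Data.Nat using (ℕ; _∸_; _*_; _^_)
open import Data.Nat.Primality using (Prime)
open import Data.Nat.DivMod using (_%_)
open import Data.Nat.Combinatorics using (_C_)
open import Relation.Binary.PropositionalEquality using (_≡_)
open import Data.Rational using (ℚ) renaming (_+_ to _+ℚ_; _-_ to _-ℚ_; _*_ to _*ℚ_)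

open import Algebra.Bundles using (CommutativeMonoid)
open import Data.Empty using (⊥-elim)
open import Data.Integer as ℤ using (ℤ; +_)
import Data.Integer.Divisibility as ℤ
import Data.Integer.Properties as ℤₚ
open import Data.Nat using (zero; suc; _+_; _<_; _≤_; s≤s; z≤n; _!)
open import Data.Nat.Combinatorics using (nCk≡n!/k![n-k]!; k![n∸k]!∣n!)
open import Data.Nat.Divisibility using (_∣_; divides; ∣-trans; m∣m*n; *-monoˡ-∣; *-cancelʳ-∣; ∣⇒≤; 1∣_; ∣1⇒≡1)
open import Data.Nat.DivMod using (_/_; m/n*n≡m; m≡m%n+[m/n]*n)
open import Data.Nat.Primality using (euclidsLemma; ¬prime[1]; prime⇒nonZero)
import Data.Nat.Properties as ℕₚ
import Data.Nat.Solver
open import Data.Product using (_,_)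
open import Data.Rational as ℚ using (0ℚ; 1ℚ; ↥_; toℚᵘ)
import Data.Rational.Properties as ℚₚ
import Data.Rational.Solver
import Data.Rational.Unnormalised as ℚᵘ
import Data.Rational.Unnormalised.Properties as ℚᵘₚ
open import Data.Sum using (inj₁; inj₂)
open import Function using (_∘_)
open import Relation.Binary.PropositionalEquality using (refl; sym; trans; cong; cong₂; subst; subst₂; module ≡-Reasoning)
open import Relation.Nullary using (¬_)

module ℕ-Solver = Data.Nat.Solver.+-*-Solver
module ℚ-Solver = Data.Rational.Solver.+-*-Solver

module BigOperator {c ℓ} (M : CommutativeMonoid c ℓ) where

  open CommutativeMonoid M renaming (Carrier to A) hiding (refl; sym; trans)
  module ≈ = CommutativeMonoid M using (refl; sym; trans)
  open import Relation.Binary.Reasoning.Setoid setoid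

  fold : (ℕ → A) → ℕ → A
  fold f zero    = ε
  fold f (suc n) = fold f n ∙ f n

  fold-cong : ∀ {f g} n → (∀ i → i < n → f i ≈ g i) → fold f n ≈ fold g n
  fold-cong zero    f≈g = ≈.refl
  fold-cong (suc n) f≈g = ∙-cong (fold-cong n (λ i i<n → f≈g i (ℕₚ.m<n⇒m<1+n i<n))) (f≈g n ℕₚ.≤-refl)

  fold-identity : ∀ {f} n → (∀ i → i < n → f i ≈ ε) → fold f n ≈ ε
  fold-identity zero    f≈ε = ≈.refl
  fold-identity (suc n) f≈ε = ≈.trans (∙-cong (fold-identity n (λ i i<n → f≈ε i (ℕₚ.m<n⇒m<1+n i<n))) (f≈ε n ℕₚ.≤-refl)) (identityˡ ε)

  fold-suc : ∀ f n → fold f (suc n) ≈ f 0 ∙ fold (f ∘ suc) n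
  fold-suc f zero    = comm ε (f 0)
  fold-suc f (suc n) = ≈.trans (∙-congʳ (fold-suc f n)) (assoc _ _ _)

  fold-∙ : ∀ f g n → fold (λ i → f i ∙ g i) n ≈ fold f n ∙ fold g n
  fold-∙ f g zero    = ≈.sym (identityˡ ε)
  fold-∙ f g (suc n) = begin
    fold (λ i → f i ∙ g i) n ∙ (f n ∙ g n) ≈⟨ ∙-congʳ (fold-∙ f g n) ⟩
    (F ∙ G) ∙ (f n ∙ g n)                  ≈⟨ assoc F G _ ⟩
    F ∙ (G ∙ (f n ∙ g n))                  ≈⟨ ∙-congˡ (assoc G (f n) (g n)) ⟨
    F ∙ ((G ∙ f n) ∙ g n)                  ≈⟨ ∙-congˡ (∙-congʳ (comm G (f n))) ⟩
    F ∙ ((f n ∙ G) ∙ g n)                  ≈⟨ ∙-congˡ (assoc (f n) G (g n)) ⟩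
    F ∙ (f n ∙ (G ∙ g n))                  ≈⟨ assoc F (f n) _ ⟨
    (F ∙ f n) ∙ (G ∙ g n)                  ∎
    where F = fold f n
          G = fold g n

  fold-+ : ∀ f m n → fold f (m + n) ≈ fold f m ∙ fold (λ i → f (m + i)) n
  fold-+ f m zero    = begin
    fold f (m + 0) ≡⟨ cong (fold f) (ℕₚ.+-identityʳ m) ⟩
    fold f m       ≈⟨ identityʳ (fold f m) ⟨
    fold f m ∙ ε   ∎
  fold-+ f m (suc n) = begin
    fold f (m + suc n)                                    ≡⟨ cong (fold f) (ℕₚ.+-suc m n) ⟩
    fold f (m + n) ∙ f (m + n)                            ≈⟨ ∙-congʳ (fold-+ f m n) ⟩
    (fold f m ∙ fold (λ i → f (m + i)) n) ∙ f (m + n)     ≈⟨ assoc _ _ _ ⟩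
    fold f m ∙ fold (λ i → f (m + i)) (suc n)             ∎

  fold-reverse : ∀ f n → fold f n ≈ fold (λ i → f (n ∸ suc i)) n
  fold-reverse f zero    = ≈.refl
  fold-reverse f (suc n) = begin
    fold f n ∙ f n                                    ≈⟨ ∙-congʳ (fold-reverse f n) ⟩
    fold (λ i → f (n ∸ suc i)) n ∙ f n                ≈⟨ comm _ _ ⟩
    f n ∙ fold (λ i → f (n ∸ suc i)) n                ≈⟨ fold-suc (λ i → f (suc n ∸ suc i)) n ⟨
    fold (λ i → f (suc n ∸ suc i)) (suc n)            ∎

  fold-evenOdd : ∀ f n → fold f (n + n) ≈ fold (λ i → f (i + i) ∙ f (suc (i + i))) n
  fold-evenOdd f zero = ≈.refl
  fold-evenOdd f (suc n) rewrite ℕₚ.+-suc n n =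
    ≈.trans (assoc _ _ _) (∙-congʳ (fold-evenOdd f n))

  fold-mirror : ∀ f n → fold f (n + n) ≈ fold (λ i → f i ∙ f (n + n ∸ suc i)) n
  fold-mirror f n = begin
    fold f (n + n)                                   ≈⟨ fold-+ f n n ⟩
    fold f n ∙ fold (λ i → f (n + i)) n              ≈⟨ ∙-congˡ (fold-reverse _ n) ⟩
    fold f n ∙ fold (λ i → f (n + (n ∸ suc i))) n    ≈⟨ ∙-congˡ (fold-cong n (λ i i<n → reflexive (cong f (sym (ℕₚ.+-∸-assoc n i<n))))) ⟩
    fold f n ∙ fold (λ i → f (n + n ∸ suc i)) n      ≈⟨ fold-∙ f _ n ⟨
    fold (λ i → f i ∙ f (n + n ∸ suc i)) n           ∎

open BigOperator ℕₚ.*-1-commutativeMonoid using () renaming (fold to ∏ℕ; fold-cong to ∏ℕ-cong; fold-mirror to ∏ℕ-mirror)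
open BigOperator ℚₚ.*-1-commutativeMonoid using () renaming (fold to ∏; fold-cong to ∏-cong; fold-identity to ∏-identity; fold-∙ to ∏-*)
open BigOperator ℚₚ.+-0-commutativeMonoid using () renaming (fold to ∑; fold-cong to ∑-cong; fold-∙ to ∑-+; fold-reverse to ∑-reverse; fold-evenOdd to ∑-evenOdd; fold-mirror to ∑-mirror)

ℤ→ℚ : ℤ → ℚ
ℤ→ℚ a = a ℚ./ 1

toℚᵘ-ℤ→ℚ : ∀ a → toℚᵘ (ℤ→ℚ a) ℚᵘ.≃ ℚᵘ.mkℚᵘ a 0
toℚᵘ-ℤ→ℚ a = ℚₚ.toℚᵘ-fromℚᵘ (ℚᵘ.mkℚᵘ a 0)

ℤ→ℚ-+ : ∀ a b → ℤ→ℚ (a ℤ.+ b) ≡ ℤ→ℚ a +ℚ ℤ→ℚ b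
ℤ→ℚ-+ a b = ℚₚ.toℚᵘ-injective (ℚᵘₚ.≃-trans (toℚᵘ-ℤ→ℚ _) (ℚᵘₚ.≃-trans unnormalised
  (ℚᵘₚ.≃-sym (ℚᵘₚ.≃-trans (ℚₚ.toℚᵘ-homo-+ (ℤ→ℚ a) (ℤ→ℚ b)) (ℚᵘₚ.+-cong (toℚᵘ-ℤ→ℚ a) (toℚᵘ-ℤ→ℚ b))))))
  where
  unnormalised : ℚᵘ.mkℚᵘ (a ℤ.+ b) 0 ℚᵘ.≃ ℚᵘ.mkℚᵘ a 0 ℚᵘ.+ ℚᵘ.mkℚᵘ b 0
  unnormalised = ℚᵘ.*≡* (trans (ℤₚ.*-identityʳ _)
    (sym (trans (ℤₚ.*-identityʳ _) (cong₂ ℤ._+_ (ℤₚ.*-identityʳ a) (ℤₚ.*-identityʳ b)))))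

ℤ→ℚ-* : ∀ a b → ℤ→ℚ (a ℤ.* b) ≡ ℤ→ℚ a *ℚ ℤ→ℚ b
ℤ→ℚ-* a b = ℚₚ.toℚᵘ-injective (ℚᵘₚ.≃-trans (toℚᵘ-ℤ→ℚ (a ℤ.* b)) (ℚᵘₚ.≃-trans (ℚᵘ.*≡* refl)
  (ℚᵘₚ.≃-sym (ℚᵘₚ.≃-trans (ℚₚ.toℚᵘ-homo-* (ℤ→ℚ a) (ℤ→ℚ b)) (ℚᵘₚ.*-cong (toℚᵘ-ℤ→ℚ a) (toℚᵘ-ℤ→ℚ b))))))

ℤ→ℚ-neg : ∀ a → ℤ→ℚ (ℤ.- a) ≡ ℚ.- ℤ→ℚ a
ℤ→ℚ-neg a = ℚₚ.toℚᵘ-injective (ℚᵘₚ.≃-trans (toℚᵘ-ℤ→ℚ _)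
  (ℚᵘₚ.≃-sym (ℚᵘₚ.≃-trans (ℚₚ.toℚᵘ-homo‿- (ℤ→ℚ a)) (ℚᵘₚ.-‿cong (toℚᵘ-ℤ→ℚ a)))))

ℕ→ℚ-+ : ∀ m n → ℕ→ℚ (m + n) ≡ ℕ→ℚ m +ℚ ℕ→ℚ n
ℕ→ℚ-+ m n = trans (cong ℤ→ℚ (ℤₚ.pos-+ m n)) (ℤ→ℚ-+ (+ m) (+ n))

ℕ→ℚ-* : ∀ m n → ℕ→ℚ (m * n) ≡ ℕ→ℚ m *ℚ ℕ→ℚ n
ℕ→ℚ-* m n = trans (cong ℤ→ℚ (ℤₚ.pos-* m n)) (ℤ→ℚ-* (+ m) (+ n))

ℕ→ℚ-∏ℕ : ∀ f n → ℕ→ℚ (∏ℕ f n) ≡ ∏ (ℕ→ℚ ∘ f) n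
ℕ→ℚ-∏ℕ f zero    = refl
ℕ→ℚ-∏ℕ f (suc n) = trans (ℕ→ℚ-* (∏ℕ f n) (f n)) (cong (_*ℚ ℕ→ℚ (f n)) (ℕ→ℚ-∏ℕ f n))

-- 1/ℕ 0 = 0 is a junk value.
1/ℕ : ℕ → ℚ
1/ℕ zero    = 0ℚ
1/ℕ (suc n) = + 1 ℚ./ suc n

ℕ→ℚ*1/ℕ≡1 : ∀ {n} → 0 < n → ℕ→ℚ n *ℚ 1/ℕ n ≡ 1ℚ
ℕ→ℚ*1/ℕ≡1 {suc n} _ = ℚₚ.toℚᵘ-injective (ℚᵘₚ.≃-trans (ℚₚ.toℚᵘ-homo-* (ℕ→ℚ (suc n)) (1/ℕ (suc n)))
  (ℚᵘₚ.≃-trans (ℚᵘₚ.*-cong (toℚᵘ-ℤ→ℚ (+ suc n)) (ℚₚ.toℚᵘ-fromℚᵘ (ℚᵘ.mkℚᵘ (+ 1) n))) unnormalised))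
  where
  unnormalised : ℚᵘ.mkℚᵘ (+ suc n) 0 ℚᵘ.* ℚᵘ.mkℚᵘ (+ 1) n ℚᵘ.≃ ℚᵘ.mkℚᵘ (+ 1) 0
  unnormalised = ℚᵘ.*≡* (cong (λ m → + suc m)
    (trans (trans (ℕₚ.*-identityʳ _) (ℕₚ.*-identityʳ n)) (sym (trans (ℕₚ.+-identityʳ _) (ℕₚ.+-identityʳ n)))))

*-cancelʳ-invertible : ∀ {a b x y} → a *ℚ b ≡ 1ℚ → x *ℚ a ≡ y *ℚ a → x ≡ y
*-cancelʳ-invertible {a} {b} {x} {y} ab≡1 xa≡ya = begin
  x                ≡⟨ ℚₚ.*-identityʳ x ⟨
  x *ℚ 1ℚ          ≡⟨ cong (x *ℚ_) (sym ab≡1) ⟩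
  x *ℚ (a *ℚ b)    ≡⟨ sym (ℚₚ.*-assoc x a b) ⟩
  x *ℚ a *ℚ b      ≡⟨ cong (_*ℚ b) xa≡ya ⟩
  y *ℚ a *ℚ b      ≡⟨ ℚₚ.*-assoc y a b ⟩
  y *ℚ (a *ℚ b)    ≡⟨ cong (y *ℚ_) ab≡1 ⟩
  y *ℚ 1ℚ          ≡⟨ ℚₚ.*-identityʳ y ⟩
  y                ∎
  where open ≡-Reasoning

1/ℕ-* : ∀ {m n} → 0 < m → 0 < n → 1/ℕ (m * n) ≡ 1/ℕ m *ℚ 1/ℕ n
1/ℕ-* {m} {n} 0<m 0<n = *-cancelʳ-invertible mn*1/mn≡1 (begin
  1/ℕ (m * n) *ℚ ℕ→ℚ (m * n)       ≡⟨ ℚₚ.*-comm _ (ℕ→ℚ (m * n)) ⟩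
  ℕ→ℚ (m * n) *ℚ 1/ℕ (m * n)       ≡⟨ mn*1/mn≡1 ⟩
  1ℚ                               ≡⟨ cong₂ _*ℚ_ (ℕ→ℚ*1/ℕ≡1 0<m) (ℕ→ℚ*1/ℕ≡1 0<n) ⟨
  (M *ℚ 1/ℕ m) *ℚ (N *ℚ 1/ℕ n)     ≡⟨ solve 4 (λ M N u v → (M :* u) :* (N :* v) := u :* v :* (M :* N)) refl M N (1/ℕ m) (1/ℕ n) ⟩
  1/ℕ m *ℚ 1/ℕ n *ℚ (M *ℚ N)       ≡⟨ cong (1/ℕ m *ℚ 1/ℕ n *ℚ_) (ℕ→ℚ-* m n) ⟨
  1/ℕ m *ℚ 1/ℕ n *ℚ ℕ→ℚ (m * n)    ∎)
  where
  open ≡-Reasoning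
  open ℚ-Solver
  M = ℕ→ℚ m
  N = ℕ→ℚ n
  mn*1/mn≡1 : ℕ→ℚ (m * n) *ℚ 1/ℕ (m * n) ≡ 1ℚ
  mn*1/mn≡1 = ℕ→ℚ*1/ℕ≡1 (ℕₚ.*-mono-< 0<m 0<n)

invCubeSuc≡1/ℕ³ : ∀ n → invCubeSuc n ≡ 1/ℕ (suc n) *ℚ 1/ℕ (suc n) *ℚ 1/ℕ (suc n)
invCubeSuc≡1/ℕ³ n = begin
  1/ℕ (suc n * (suc n * (suc n * 1)))     ≡⟨ cong (λ m → 1/ℕ (suc n * (suc n * m))) (ℕₚ.*-identityʳ (suc n)) ⟩
  1/ℕ (suc n * (suc n * suc n))            ≡⟨ 1/ℕ-* 0<n+1 (ℕₚ.*-mono-< 0<n+1 0<n+1) ⟩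
  u *ℚ 1/ℕ (suc n * suc n)                 ≡⟨ cong (u *ℚ_) (1/ℕ-* 0<n+1 0<n+1) ⟩
  u *ℚ (u *ℚ u)                            ≡⟨ ℚₚ.*-assoc u u u ⟨
  u *ℚ u *ℚ u                              ∎
  where open ≡-Reasoning
        u = 1/ℕ (suc n)
        0<n+1 = s≤s (z≤n {n})

1/ℕ²≡4*1/ℕ[n+n]² : ∀ {n} → 0 < n → 1/ℕ n *ℚ 1/ℕ n ≡ ℕ→ℚ 4 *ℚ (1/ℕ (n + n) *ℚ 1/ℕ (n + n))
1/ℕ²≡4*1/ℕ[n+n]² {n} 0<n = sym (begin
  ℕ→ℚ 4 *ℚ (1/ℕ (n + n) *ℚ 1/ℕ (n + n))              ≡⟨ cong (λ w → ℕ→ℚ 4 *ℚ (w *ℚ w)) 1/[n+n]≡1/2*1/n ⟩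
  ℕ→ℚ 4 *ℚ (1/ℕ 2 *ℚ u *ℚ (1/ℕ 2 *ℚ u))              ≡⟨ solve 3 (λ F H u → F :* (H :* u :* (H :* u)) := F :* H :* H :* (u :* u)) refl (ℕ→ℚ 4) (1/ℕ 2) u ⟩
  ℕ→ℚ 4 *ℚ 1/ℕ 2 *ℚ 1/ℕ 2 *ℚ (u *ℚ u)                ≡⟨ ℚₚ.*-identityˡ (u *ℚ u) ⟩
  u *ℚ u                                             ∎)
  where open ≡-Reasoning
        open ℚ-Solver
        u = 1/ℕ n
        1/[n+n]≡1/2*1/n : 1/ℕ (n + n) ≡ 1/ℕ 2 *ℚ u
        1/[n+n]≡1/2*1/n = trans (cong (λ m → 1/ℕ (n + m)) (sym (ℕₚ.+-identityʳ n))) (1/ℕ-* {2} (s≤s z≤n) 0<n)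

sumInvCube≡∑ : ∀ n → sumInvCube n ≡ ∑ invCubeSuc n
sumInvCube≡∑ zero    = refl
sumInvCube≡∑ (suc n) = cong (_+ℚ invCubeSuc n) (sumInvCube≡∑ n)

module _ {t s : ℕ} (0<t : 0 < t) (0<s : 0 < s) where

  private
    T S u v : ℚ
    T = ℕ→ℚ t
    S = ℕ→ℚ s
    u = 1/ℕ t
    v = 1/ℕ s

  open ≡-Reasoning
  open ℚ-Solver

  1/ℕ-+ : 1/ℕ t +ℚ 1/ℕ s ≡ ℕ→ℚ (t + s) *ℚ (1/ℕ t *ℚ 1/ℕ s)
  1/ℕ-+ = begin
    u +ℚ v                        ≡⟨ solve 2 (λ u v → u :+ v := con 1ℚ :* v :+ con 1ℚ :* u) refl u v ⟩
    1ℚ *ℚ v +ℚ 1ℚ *ℚ u            ≡⟨ cong₂ (λ a b → a *ℚ v +ℚ b *ℚ u) (ℕ→ℚ*1/ℕ≡1 0<t) (ℕ→ℚ*1/ℕ≡1 0<s) ⟨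
    T *ℚ u *ℚ v +ℚ S *ℚ v *ℚ u    ≡⟨ solve 4 (λ T S u v → T :* u :* v :+ S :* v :* u := (T :+ S) :* (u :* v)) refl T S u v ⟩
    (T +ℚ S) *ℚ (u *ℚ v)          ≡⟨ cong (_*ℚ (u *ℚ v)) (ℕ→ℚ-+ t s) ⟨
    ℕ→ℚ (t + s) *ℚ (u *ℚ v)       ∎

  1/ℕ-sub : 1/ℕ s -ℚ 1/ℕ t ≡ (ℕ→ℚ t -ℚ ℕ→ℚ s) *ℚ (1/ℕ t *ℚ 1/ℕ s)
  1/ℕ-sub = begin
    v -ℚ u                        ≡⟨ solve 2 (λ u v → v :- u := con 1ℚ :* v :- con 1ℚ :* u) refl u v ⟩
    1ℚ *ℚ v -ℚ 1ℚ *ℚ u            ≡⟨ cong₂ (λ a b → a *ℚ v -ℚ b *ℚ u) (ℕ→ℚ*1/ℕ≡1 0<t) (ℕ→ℚ*1/ℕ≡1 0<s) ⟨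
    T *ℚ u *ℚ v -ℚ S *ℚ v *ℚ u    ≡⟨ solve 4 (λ T S u v → T :* u :* v :- S :* v :* u := (T :- S) :* (u :* v)) refl T S u v ⟩
    (T -ℚ S) *ℚ (u *ℚ v)          ∎

∑-*ˡ : ∀ c f n → ∑ (λ i → c *ℚ f i) n ≡ c *ℚ ∑ f n
∑-*ˡ c f zero    = sym (ℚₚ.*-zeroʳ c)
∑-*ˡ c f (suc n) = trans (cong (_+ℚ c *ℚ f n) (∑-*ˡ c f n)) (sym (ℚₚ.*-distribˡ-+ c (∑ f n) (f n)))

∑-sub : ∀ f g n → ∑ (λ i → f i -ℚ g i) n ≡ ∑ f n -ℚ ∑ g n
∑-sub f g zero    = refl
∑-sub f g (suc n) = trans (cong (_+ℚ (f n -ℚ g n)) (∑-sub f g n))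
  (solve 4 (λ F G a b → F :- G :+ (a :- b) := F :+ a :- (G :+ b)) refl (∑ f n) (∑ g n) (f n) (g n))
  where open ℚ-Solver

e₂ : (ℕ → ℚ) → ℕ → ℚ
e₂ z zero    = 0ℚ
e₂ z (suc n) = e₂ z n +ℚ ∑ z n *ℚ z n

2*e₂≡∑²-∑sq : ∀ z n → ℕ→ℚ 2 *ℚ e₂ z n ≡ ∑ z n *ℚ ∑ z n -ℚ ∑ (λ i → z i *ℚ z i) n
2*e₂≡∑²-∑sq z zero    = refl
2*e₂≡∑²-∑sq z (suc n) = begin
  ℕ→ℚ 2 *ℚ (e₂ z n +ℚ Z *ℚ t)                  ≡⟨ solve 3 (λ e Z t → con (ℕ→ℚ 2) :* (e :+ Z :* t) := con (ℕ→ℚ 2) :* e :+ con (ℕ→ℚ 2) :* Z :* t) refl (e₂ z n) Z t ⟩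
  ℕ→ℚ 2 *ℚ e₂ z n +ℚ ℕ→ℚ 2 *ℚ Z *ℚ t           ≡⟨ cong (_+ℚ ℕ→ℚ 2 *ℚ Z *ℚ t) (2*e₂≡∑²-∑sq z n) ⟩
  Z *ℚ Z -ℚ Q +ℚ ℕ→ℚ 2 *ℚ Z *ℚ t               ≡⟨ solve 3 (λ Z Q t → Z :* Z :- Q :+ con (ℕ→ℚ 2) :* Z :* t := (Z :+ t) :* (Z :+ t) :- (Q :+ t :* t)) refl Z Q t ⟩
  (Z +ℚ t) *ℚ (Z +ℚ t) -ℚ (Q +ℚ t *ℚ t)        ∎
  where open ≡-Reasoning
        open ℚ-Solver
        Z = ∑ z n
        Q = ∑ (λ i → z i *ℚ z i) n
        t = z n

module Valuation (p : ℕ) (p-prime : Prime p) where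

  private
    p∤-* : ∀ {m n} → ¬ p ∣ m → ¬ p ∣ n → ¬ p ∣ m * n
    p∤-* {m} {n} p∤m p∤n p∣mn with euclidsLemma m n p-prime p∣mn
    ... | inj₁ p∣m = p∤m p∣m
    ... | inj₂ p∣n = p∤n p∣n

    p∤1 : ¬ p ∣ 1
    p∤1 p∣1 = ¬prime[1] (subst Prime (∣1⇒≡1 p∣1) p-prime)

  p∤0<n<p : ∀ {n} → 0 < n → n < p → ¬ p ∣ n
  p∤0<n<p {suc n} _ n<p p∣n = ℕₚ.<⇒≱ n<p (∣⇒≤ p∣n)

  p^k∣coprime*n⇒p^k∣n : ∀ k {m n} → ¬ p ∣ m → p ^ k ∣ m * n → p ^ k ∣ n
  p^k∣coprime*n⇒p^k∣n zero          _   _ = 1∣ _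
  p^k∣coprime*n⇒p^k∣n (suc k) {m} {n} p∤m p^k+1∣mn with euclidsLemma m n p-prime (∣-trans (m∣m*n (p ^ k)) p^k+1∣mn)
  ... | inj₁ p∣m = ⊥-elim (p∤m p∣m)
  ... | inj₂ (divides n′ refl) =
    subst (_∣ n′ * p) (ℕₚ.*-comm (p ^ k) p)
      (*-monoˡ-∣ p (p^k∣coprime*n⇒p^k∣n k p∤m (*-cancelʳ-∣ p {{prime⇒nonZero p-prime}}
        (subst₂ _∣_ (ℕₚ.*-comm p (p ^ k)) (sym (ℕₚ.*-assoc m n′ p)) p^k+1∣mn))))

  -- k ≤ᵥ q says k ≤ v_p(q), i.e. q ∈ p ^ k ℤ₍ₚ₎.
  infix 4 _≤ᵥ_
  record _≤ᵥ_ (k : ℕ) (q : ℚ) : Set where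
    constructor ≤ᵥ-intro
    field
      unit       : ℕ
      quotient   : ℤ
      p∤unit     : ¬ p ∣ unit
      factorised : ℕ→ℚ unit *ℚ q ≡ ℕ→ℚ (p ^ k) *ℚ ℤ→ℚ quotient

  open ≡-Reasoning
  open ℚ-Solver

  ≤ᵥ-+ : ∀ {k q r} → k ≤ᵥ q → k ≤ᵥ r → k ≤ᵥ q +ℚ r
  ≤ᵥ-+ {k} {q} {r} (≤ᵥ-intro b₁ a₁ p∤b₁ e₁) (≤ᵥ-intro b₂ a₂ p∤b₂ e₂) =
    ≤ᵥ-intro (b₁ * b₂) (+ b₂ ℤ.* a₁ ℤ.+ + b₁ ℤ.* a₂) (p∤-* p∤b₁ p∤b₂) (begin
      ℕ→ℚ (b₁ * b₂) *ℚ (q +ℚ r)                  ≡⟨ cong (_*ℚ (q +ℚ r)) (ℕ→ℚ-* b₁ b₂) ⟩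
      B₁ *ℚ B₂ *ℚ (q +ℚ r)                       ≡⟨ solve 4 (λ B₁ B₂ q r → B₁ :* B₂ :* (q :+ r) := B₂ :* (B₁ :* q) :+ B₁ :* (B₂ :* r)) refl B₁ B₂ q r ⟩
      B₂ *ℚ (B₁ *ℚ q) +ℚ B₁ *ℚ (B₂ *ℚ r)         ≡⟨ cong₂ (λ x y → B₂ *ℚ x +ℚ B₁ *ℚ y) e₁ e₂ ⟩
      B₂ *ℚ (K *ℚ A₁) +ℚ B₁ *ℚ (K *ℚ A₂)         ≡⟨ solve 5 (λ B₁ B₂ K A₁ A₂ → B₂ :* (K :* A₁) :+ B₁ :* (K :* A₂) := K :* (B₂ :* A₁ :+ B₁ :* A₂)) refl B₁ B₂ K A₁ A₂ ⟩
      K *ℚ (B₂ *ℚ A₁ +ℚ B₁ *ℚ A₂)                ≡⟨ cong (K *ℚ_) (trans (ℤ→ℚ-+ (+ b₂ ℤ.* a₁) (+ b₁ ℤ.* a₂)) (cong₂ _+ℚ_ (ℤ→ℚ-* (+ b₂) a₁) (ℤ→ℚ-* (+ b₁) a₂))) ⟨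
      K *ℚ ℤ→ℚ (+ b₂ ℤ.* a₁ ℤ.+ + b₁ ℤ.* a₂)     ∎)
    where B₁ = ℕ→ℚ b₁
          B₂ = ℕ→ℚ b₂
          A₁ = ℤ→ℚ a₁
          A₂ = ℤ→ℚ a₂
          K = ℕ→ℚ (p ^ k)

  ≤ᵥ-* : ∀ {k l q r} → k ≤ᵥ q → l ≤ᵥ r → k + l ≤ᵥ q *ℚ r
  ≤ᵥ-* {k} {l} {q} {r} (≤ᵥ-intro b₁ a₁ p∤b₁ e₁) (≤ᵥ-intro b₂ a₂ p∤b₂ e₂) =
    ≤ᵥ-intro (b₁ * b₂) (a₁ ℤ.* a₂) (p∤-* p∤b₁ p∤b₂) (begin
      ℕ→ℚ (b₁ * b₂) *ℚ (q *ℚ r)              ≡⟨ cong (_*ℚ (q *ℚ r)) (ℕ→ℚ-* b₁ b₂) ⟩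
      B₁ *ℚ B₂ *ℚ (q *ℚ r)                   ≡⟨ solve 4 (λ B₁ B₂ q r → B₁ :* B₂ :* (q :* r) := (B₁ :* q) :* (B₂ :* r)) refl B₁ B₂ q r ⟩
      (B₁ *ℚ q) *ℚ (B₂ *ℚ r)                 ≡⟨ cong₂ _*ℚ_ e₁ e₂ ⟩
      (K *ℚ A₁) *ℚ (L *ℚ A₂)                 ≡⟨ solve 4 (λ K L A₁ A₂ → (K :* A₁) :* (L :* A₂) := (K :* L) :* (A₁ :* A₂)) refl K L A₁ A₂ ⟩
      (K *ℚ L) *ℚ (A₁ *ℚ A₂)                 ≡⟨ cong₂ _*ℚ_ (trans (cong ℕ→ℚ (ℕₚ.^-distribˡ-+-* p k l)) (ℕ→ℚ-* (p ^ k) (p ^ l))) (ℤ→ℚ-* a₁ a₂) ⟨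
      ℕ→ℚ (p ^ (k + l)) *ℚ ℤ→ℚ (a₁ ℤ.* a₂)   ∎)
    where B₁ = ℕ→ℚ b₁
          B₂ = ℕ→ℚ b₂
          A₁ = ℤ→ℚ a₁
          A₂ = ℤ→ℚ a₂
          K = ℕ→ℚ (p ^ k)
          L = ℕ→ℚ (p ^ l)

  ≤ᵥ-neg : ∀ {k q} → k ≤ᵥ q → k ≤ᵥ ℚ.- q
  ≤ᵥ-neg {k} {q} (≤ᵥ-intro b a p∤b e) = ≤ᵥ-intro b (ℤ.- a) p∤b (begin
    ℕ→ℚ b *ℚ ℚ.- q                  ≡⟨ ℚₚ.neg-distribʳ-* (ℕ→ℚ b) q ⟨
    ℚ.- (ℕ→ℚ b *ℚ q)                ≡⟨ cong ℚ.-_ e ⟩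
    ℚ.- (ℕ→ℚ (p ^ k) *ℚ ℤ→ℚ a)      ≡⟨ ℚₚ.neg-distribʳ-* (ℕ→ℚ (p ^ k)) (ℤ→ℚ a) ⟩
    ℕ→ℚ (p ^ k) *ℚ ℚ.- ℤ→ℚ a        ≡⟨ cong (ℕ→ℚ (p ^ k) *ℚ_) (ℤ→ℚ-neg a) ⟨
    ℕ→ℚ (p ^ k) *ℚ ℤ→ℚ (ℤ.- a)      ∎)

  ≤ᵥ-sub : ∀ {k q r} → k ≤ᵥ q → k ≤ᵥ r → k ≤ᵥ q -ℚ r
  ≤ᵥ-sub k≤q k≤r = ≤ᵥ-+ k≤q (≤ᵥ-neg k≤r)

  ≤ᵥ-resp-≡ : ∀ {k q r} → q ≡ r → k ≤ᵥ q → k ≤ᵥ r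
  ≤ᵥ-resp-≡ {k} = subst (k ≤ᵥ_)

  ≤ᵥ-0 : ∀ k → k ≤ᵥ 0ℚ
  ≤ᵥ-0 k = ≤ᵥ-intro 1 (+ 0) p∤1 (trans (ℚₚ.*-zeroʳ 1ℚ) (sym (ℚₚ.*-zeroʳ (ℕ→ℚ (p ^ k)))))

  0≤ᵥℕ : ∀ n → 0 ≤ᵥ ℕ→ℚ n
  0≤ᵥℕ n = ≤ᵥ-intro 1 (+ n) p∤1 refl

  k≤ᵥp^k : ∀ k → k ≤ᵥ ℕ→ℚ (p ^ k)
  k≤ᵥp^k k = ≤ᵥ-intro 1 (+ 1) p∤1 (trans (ℚₚ.*-identityˡ (ℕ→ℚ (p ^ k))) (sym (ℚₚ.*-identityʳ (ℕ→ℚ (p ^ k)))))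

  1≤ᵥp : 1 ≤ᵥ ℕ→ℚ p
  1≤ᵥp = subst (λ n → 1 ≤ᵥ ℕ→ℚ n) (ℕₚ.*-identityʳ p) (k≤ᵥp^k 1)

  0≤ᵥ1/ℕ : ∀ {n} → ¬ p ∣ n → 0 ≤ᵥ 1/ℕ n
  0≤ᵥ1/ℕ {zero}  p∤0 = ⊥-elim (p∤0 (divides 0 refl))
  0≤ᵥ1/ℕ {suc n} p∤n = ≤ᵥ-intro (suc n) (+ 1) p∤n (ℕ→ℚ*1/ℕ≡1 {suc n} (s≤s z≤n))

  ≤ᵥ-weaken : ∀ {k m q} → k ≤ m → m ≤ᵥ q → k ≤ᵥ q
  ≤ᵥ-weaken {k} {m} {q} k≤m (≤ᵥ-intro b a p∤b e) with ℕₚ.m≤n⇒∃[o]m+o≡n k≤m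
  ... | d , refl = ≤ᵥ-intro b (+ (p ^ d) ℤ.* a) p∤b (begin
    ℕ→ℚ b *ℚ q                                ≡⟨ e ⟩
    ℕ→ℚ (p ^ (k + d)) *ℚ ℤ→ℚ a                ≡⟨ cong (λ n → ℕ→ℚ n *ℚ ℤ→ℚ a) (ℕₚ.^-distribˡ-+-* p k d) ⟩
    ℕ→ℚ (p ^ k * p ^ d) *ℚ ℤ→ℚ a              ≡⟨ cong (_*ℚ ℤ→ℚ a) (ℕ→ℚ-* (p ^ k) (p ^ d)) ⟩
    ℕ→ℚ (p ^ k) *ℚ ℕ→ℚ (p ^ d) *ℚ ℤ→ℚ a       ≡⟨ ℚₚ.*-assoc (ℕ→ℚ (p ^ k)) _ _ ⟩
    ℕ→ℚ (p ^ k) *ℚ (ℕ→ℚ (p ^ d) *ℚ ℤ→ℚ a)     ≡⟨ cong (ℕ→ℚ (p ^ k) *ℚ_) (ℤ→ℚ-* (+ (p ^ d)) a) ⟨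
    ℕ→ℚ (p ^ k) *ℚ ℤ→ℚ (+ (p ^ d) ℤ.* a)      ∎)

  ≤ᵥ-cancel-unit : ∀ {k q} c → ¬ p ∣ c → k ≤ᵥ ℕ→ℚ c *ℚ q → k ≤ᵥ q
  ≤ᵥ-cancel-unit {k} {q} c p∤c (≤ᵥ-intro b a p∤b e) = ≤ᵥ-intro (b * c) a (p∤-* p∤b p∤c)
    (trans (cong (_*ℚ q) (ℕ→ℚ-* b c)) (trans (ℚₚ.*-assoc (ℕ→ℚ b) (ℕ→ℚ c) q) e))

  ≤ᵥ-∑ : ∀ {k} f n → (∀ i → i < n → k ≤ᵥ f i) → k ≤ᵥ ∑ f n
  ≤ᵥ-∑ {k} f zero    _      = ≤ᵥ-0 k
  ≤ᵥ-∑     f (suc n) k≤ᵥf = ≤ᵥ-+ (≤ᵥ-∑ f n (λ i i<n → k≤ᵥf i (ℕₚ.m<n⇒m<1+n i<n))) (k≤ᵥf n ℕₚ.≤-refl)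

  ≤ᵥ-∑-sub : ∀ {k} f g n → (∀ i → i < n → k ≤ᵥ f i -ℚ g i) → k ≤ᵥ ∑ f n -ℚ ∑ g n
  ≤ᵥ-∑-sub f g n k≤ᵥf-g = ≤ᵥ-resp-≡ (∑-sub f g n) (≤ᵥ-∑ _ n k≤ᵥf-g)

  ≤ᵥ⇒p^k∣↥ : ∀ {k q} → k ≤ᵥ q → + (p ^ k) ℤ.∣ ↥ q
  ≤ᵥ⇒p^k∣↥ {k} {q@(ℚ.mkℚ c d _)} (≤ᵥ-intro b a p∤b e) =
    p^k∣coprime*n⇒p^k∣n k p∤b (subst (p ^ k ∣_) |cross|≡ p^k∣|cross|)
    where
    unnormalised : ℚᵘ.mkℚᵘ (+ b) 0 ℚᵘ.* ℚᵘ.mkℚᵘ c d ℚᵘ.≃ ℚᵘ.mkℚᵘ (+ (p ^ k)) 0 ℚᵘ.* ℚᵘ.mkℚᵘ a 0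
    unnormalised = ℚᵘₚ.≃-trans (ℚᵘₚ.≃-sym (ℚᵘₚ.≃-trans (ℚₚ.toℚᵘ-homo-* (ℕ→ℚ b) q) (ℚᵘₚ.*-cong (toℚᵘ-ℤ→ℚ (+ b)) ℚᵘₚ.≃-refl)))
      (ℚᵘₚ.≃-trans (ℚₚ.toℚᵘ-cong e) (ℚᵘₚ.≃-trans (ℚₚ.toℚᵘ-homo-* (ℕ→ℚ (p ^ k)) (ℤ→ℚ a)) (ℚᵘₚ.*-cong (toℚᵘ-ℤ→ℚ (+ (p ^ k))) (toℚᵘ-ℤ→ℚ a))))
    cross : (+ b ℤ.* c) ℤ.* + 1 ≡ (+ (p ^ k) ℤ.* a) ℤ.* + suc (d + 0)
    cross with unnormalised
    ... | ℚᵘ.*≡* eq = eq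
    |cross|≡ : ℤ.∣ (+ (p ^ k) ℤ.* a) ℤ.* + suc (d + 0) ∣ ≡ b * ℤ.∣ c ∣
    |cross|≡ = trans (cong ℤ.∣_∣ (sym cross)) (trans (cong ℤ.∣_∣ (ℤₚ.*-identityʳ (+ b ℤ.* c))) (ℤₚ.abs-* (+ b) c))
    p^k∣|cross| : p ^ k ∣ ℤ.∣ (+ (p ^ k) ℤ.* a) ℤ.* + suc (d + 0) ∣
    p^k∣|cross| = subst (p ^ k ∣_) (sym (trans (ℤₚ.abs-* (+ (p ^ k) ℤ.* a) (+ suc (d + 0))) (cong (_* suc (d + 0)) (ℤₚ.abs-* (+ (p ^ k)) a))))
      (∣-trans (m∣m*n ℤ.∣ a ∣) (m∣m*n (suc (d + 0))))

  0≤ᵥe₂ : ∀ z n → (∀ i → i < n → 0 ≤ᵥ z i) → 0 ≤ᵥ e₂ z n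
  0≤ᵥe₂ z zero    _      = ≤ᵥ-0 0
  0≤ᵥe₂ z (suc n) 0≤ᵥz = ≤ᵥ-+ (0≤ᵥe₂ z n 0≤ᵥz′) (≤ᵥ-* (≤ᵥ-∑ z n 0≤ᵥz′) (0≤ᵥz n ℕₚ.≤-refl))
    where 0≤ᵥz′ = λ i i<n → 0≤ᵥz i (ℕₚ.m<n⇒m<1+n i<n)

  ∏[1+x*z]-expansion : ∀ {k x} z n → k ≤ᵥ x → (∀ i → i < n → 0 ≤ᵥ z i) →
    3 * k ≤ᵥ ∏ (λ i → 1ℚ +ℚ x *ℚ z i) n -ℚ (1ℚ +ℚ x *ℚ ∑ z n +ℚ x *ℚ x *ℚ e₂ z n)
  ∏[1+x*z]-expansion {k} {x} z zero k≤ᵥx _ = ≤ᵥ-resp-≡ (sym (solve 1 (λ x →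
    con 1ℚ :- (con 1ℚ :+ x :* con 0ℚ :+ x :* x :* con 0ℚ) := con 0ℚ) refl x)) (≤ᵥ-0 (3 * k))
  ∏[1+x*z]-expansion {k} {x} z (suc n) k≤ᵥx 0≤ᵥz = ≤ᵥ-resp-≡ (sym remainder)
    (≤ᵥ-+ (≤ᵥ-* 0≤ᵥ1+xt (∏[1+x*z]-expansion z n k≤ᵥx 0≤ᵥz′))
          (≤ᵥ-* k≤ᵥx (≤ᵥ-* k≤ᵥx (≤ᵥ-* k≤ᵥx (≤ᵥ-* (0≤ᵥe₂ z n 0≤ᵥz′) (0≤ᵥz n ℕₚ.≤-refl))))))
    where
    0≤ᵥz′ = λ i i<n → 0≤ᵥz i (ℕₚ.m<n⇒m<1+n i<n)
    G = ∏ (λ i → 1ℚ +ℚ x *ℚ z i) n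
    Z = ∑ z n
    t = z n
    0≤ᵥ1+xt : 0 ≤ᵥ 1ℚ +ℚ x *ℚ t
    0≤ᵥ1+xt = ≤ᵥ-+ (0≤ᵥℕ 1) (≤ᵥ-* (≤ᵥ-weaken z≤n k≤ᵥx) (0≤ᵥz n ℕₚ.≤-refl))
    remainder : G *ℚ (1ℚ +ℚ x *ℚ t) -ℚ (1ℚ +ℚ x *ℚ (Z +ℚ t) +ℚ x *ℚ x *ℚ (e₂ z n +ℚ Z *ℚ t))
              ≡ (1ℚ +ℚ x *ℚ t) *ℚ (G -ℚ (1ℚ +ℚ x *ℚ Z +ℚ x *ℚ x *ℚ e₂ z n)) +ℚ x *ℚ (x *ℚ (x *ℚ (e₂ z n *ℚ t)))
    remainder = solve 5 (λ G x Z e t →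
      G :* (con 1ℚ :+ x :* t) :- (con 1ℚ :+ x :* (Z :+ t) :+ x :* x :* (e :+ Z :* t))
      := (con 1ℚ :+ x :* t) :* (G :- (con 1ℚ :+ x :* Z :+ x :* x :* e)) :+ x :* (x :* (x :* (e :* t)))) refl G x Z (e₂ z n) t

  module _ {t s : ℕ} (0<t : 0 < t) (0<s : 0 < s) (t+s≡p : t + s ≡ p) where

    private
      p∤t : ¬ p ∣ t
      p∤t = p∤0<n<p 0<t (subst (t <_) t+s≡p (ℕₚ.m<m+n t 0<s))

      p∤s : ¬ p ∣ s
      p∤s = p∤0<n<p 0<s (subst (s <_) (trans (ℕₚ.+-comm s t) t+s≡p) (ℕₚ.m<m+n s 0<t))

    0≤ᵥ1/ts : 0 ≤ᵥ 1/ℕ t *ℚ 1/ℕ s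
    0≤ᵥ1/ts = ≤ᵥ-* (0≤ᵥ1/ℕ p∤t) (0≤ᵥ1/ℕ p∤s)

    1≤ᵥ1/t+1/s : 1 ≤ᵥ 1/ℕ t +ℚ 1/ℕ s
    1≤ᵥ1/t+1/s = ≤ᵥ-resp-≡ (sym (trans (1/ℕ-+ 0<t 0<s) (cong (λ n → ℕ→ℚ n *ℚ (1/ℕ t *ℚ 1/ℕ s)) t+s≡p)))
      (≤ᵥ-* 1≤ᵥp 0≤ᵥ1/ts)

    1≤ᵥ1/ts+1/t² : 1 ≤ᵥ 1/ℕ t *ℚ 1/ℕ s +ℚ 1/ℕ t *ℚ 1/ℕ t
    1≤ᵥ1/ts+1/t² = ≤ᵥ-resp-≡ (solve 2 (λ u v → u :* (u :+ v) := u :* v :+ u :* u) refl (1/ℕ t) (1/ℕ s))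
      (≤ᵥ-* (0≤ᵥ1/ℕ p∤t) 1≤ᵥ1/t+1/s)

    1≤ᵥ1/s²-1/t² : 1 ≤ᵥ 1/ℕ s *ℚ 1/ℕ s -ℚ 1/ℕ t *ℚ 1/ℕ t
    1≤ᵥ1/s²-1/t² = ≤ᵥ-resp-≡ (trans (cong (_*ℚ (1/ℕ t +ℚ 1/ℕ s)) (sym (1/ℕ-sub 0<t 0<s)))
        (solve 2 (λ u v → (v :- u) :* (u :+ v) := v :* v :- u :* u) refl (1/ℕ t) (1/ℕ s)))
      (≤ᵥ-* (≤ᵥ-* (≤ᵥ-sub (0≤ᵥℕ t) (0≤ᵥℕ s)) 0≤ᵥ1/ts) 1≤ᵥ1/t+1/s)

C*k!*[n∸k]!≡n! : ∀ {n k} → k ≤ n → (n C k) * (k ! * (n ∸ k) !) ≡ n !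
C*k!*[n∸k]!≡n! {n} {k} k≤n = trans (cong (_* (k ! * (n ∸ k) !)) (nCk≡n!/k![n-k]! k≤n)) (m/n*n≡m (k![n∸k]!∣n! k≤n))
  where instance _ = ℕₚ._!*_!≢0 k (n ∸ k)

[1+n]C[1+k]*[1+k]≡[1+n]*nCk : ∀ {n k} → k ≤ n → (suc n C suc k) * suc k ≡ suc n * (n C k)
[1+n]C[1+k]*[1+k]≡[1+n]*nCk {n} {k} k≤n = ℕₚ.*-cancelʳ-≡ _ _ (k ! * (n ∸ k) !) (begin
  (suc n C suc k) * suc k * (k ! * (n ∸ k) !)        ≡⟨ solve 4 (λ c s f g → c :* s :* (f :* g) := c :* (s :* f :* g)) refl (suc n C suc k) (suc k) (k !) ((n ∸ k) !) ⟩
  (suc n C suc k) * (suc k ! * (suc n ∸ suc k) !)    ≡⟨ C*k!*[n∸k]!≡n! (s≤s k≤n) ⟩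
  suc n * n !                                        ≡⟨ cong (suc n *_) (C*k!*[n∸k]!≡n! k≤n) ⟨
  suc n * ((n C k) * (k ! * (n ∸ k) !))              ≡⟨ ℕₚ.*-assoc (suc n) (n C k) _ ⟨
  suc n * (n C k) * (k ! * (n ∸ k) !)                ∎)
  where open ≡-Reasoning
        open ℕ-Solver
        instance _ = ℕₚ._!*_!≢0 k (n ∸ k)

[m+k]Ck*k!≡∏ : ∀ m k → ((m + k) C k) * k ! ≡ ∏ℕ (λ i → m + suc i) k
[m+k]Ck*k!≡∏ m zero    = refl
[m+k]Ck*k!≡∏ m (suc k) = begin
  ((m + suc k) C suc k) * (suc k * k !)       ≡⟨ cong (λ n → (n C suc k) * (suc k * k !)) (ℕₚ.+-suc m k) ⟩
  (suc (m + k) C suc k) * (suc k * k !)       ≡⟨ ℕₚ.*-assoc (suc (m + k) C suc k) (suc k) (k !) ⟨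
  (suc (m + k) C suc k) * suc k * k !         ≡⟨ cong (_* k !) ([1+n]C[1+k]*[1+k]≡[1+n]*nCk (ℕₚ.m≤n+m k m)) ⟩
  suc (m + k) * ((m + k) C k) * k !           ≡⟨ ℕₚ.*-assoc (suc (m + k)) ((m + k) C k) (k !) ⟩
  suc (m + k) * (((m + k) C k) * k !)         ≡⟨ cong₂ _*_ (sym (ℕₚ.+-suc m k)) ([m+k]Ck*k!≡∏ m k) ⟩
  (m + suc k) * ∏ℕ (λ i → m + suc i) k        ≡⟨ ℕₚ.*-comm (m + suc k) _ ⟩
  ∏ℕ (λ i → m + suc i) (suc k)                ∎
  where open ≡-Reasoning

n!≡∏ : ∀ n → n ! ≡ ∏ℕ suc n
n!≡∏ zero    = refl
n!≡∏ (suc n) = trans (cong (suc n *_) (n!≡∏ n)) (ℕₚ.*-comm (suc n) (∏ℕ suc n))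

module OddPairing (h : ℕ) where

  p : ℕ
  p = suc (h + h)

  P : ℚ
  P = ℕ→ℚ p

  mirror : ℕ → ℕ
  mirror i = p ∸ suc i

  module _ {i : ℕ} (i<h : i < h) where

    1+i<p : suc i < p
    1+i<p = s≤s (ℕₚ.≤-trans i<h (ℕₚ.m≤m+n h h))

    1+i+mirror≡p : suc i + mirror i ≡ p
    1+i+mirror≡p = ℕₚ.m+[n∸m]≡n (ℕₚ.<⇒≤ 1+i<p)

    0<mirror : 0 < mirror i
    0<mirror = ℕₚ.m<n⇒0<n∸m 1+i<p

    1+[2h∸[1+i]]≡mirror : suc (h + h ∸ suc i) ≡ mirror i
    1+[2h∸[1+i]]≡mirror = sym (ℕₚ.+-∸-assoc 1 (ℕₚ.≤-trans i<h (ℕₚ.m≤m+n h h)))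

    2i+2<p : suc (suc (i + i)) < p
    2i+2<p = s≤s (subst (_≤ h + h) (ℕₚ.+-suc (suc i) i) (ℕₚ.+-mono-≤ i<h i<h))

    1+2[h∸[1+i]]≡p∸[2i+2] : suc ((h ∸ suc i) + (h ∸ suc i)) ≡ p ∸ suc (suc (i + i))
    1+2[h∸[1+i]]≡p∸[2i+2] with ℕₚ.m≤n⇒∃[o]m+o≡n i<h
    ... | d , refl = begin
      suc ((suc i + d ∸ suc i) + (suc i + d ∸ suc i))        ≡⟨ cong (λ e → suc (e + e)) (ℕₚ.m+n∸m≡n (suc i) d) ⟩
      suc (d + d)                                            ≡⟨ ℕₚ.m+n∸n≡m (suc (d + d)) (suc (suc (i + i))) ⟨
      suc (d + d) + suc (suc (i + i)) ∸ suc (suc (i + i))    ≡⟨ cong (_∸ suc (suc (i + i))) (solve 2 (λ i d →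
                                                                  con 1 :+ (d :+ d) :+ (con 2 :+ (i :+ i)) := con 1 :+ ((con 1 :+ i :+ d) :+ (con 1 :+ i :+ d))) refl i d) ⟩
      suc ((suc i + d) + (suc i + d)) ∸ suc (suc (i + i))    ∎
      where open ≡-Reasoning
            open ℕ-Solver

  z : ℕ → ℚ
  z i = 1/ℕ (suc i) *ℚ 1/ℕ (mirror i)

  x : ℕ → ℚ
  x c = ℕ→ℚ c *ℚ (P *ℚ P)

  -- For c = m(m + 1), G c = C(mp + p, p)/(m + 1) and E c is its truncation mod p⁶.
  G E : ℕ → ℚ
  G c = ∏ (λ i → 1ℚ +ℚ x c *ℚ z i) h
  E c = 1ℚ +ℚ x c *ℚ ∑ z h +ℚ x c *ℚ x c *ℚ e₂ z h

  Q₂ Q₃ : ℚ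
  Q₂ = ∑ (λ i → z i *ℚ z i) h
  Q₃ = ∑ (λ i → z i *ℚ z i *ℚ z i) h

  -- C(M + p, p) p! = ∏_{t=1}^{p} (M + t), and (M + t)(M + p - t) = t(p - t) + M(M + p).
  C[M+p,p]-pairing : ∀ M → ((M + p) C p) * (∏ℕ (λ i → suc i * mirror i) h * p)
                         ≡ ∏ℕ (λ i → suc i * mirror i + M * (M + p)) h * (M + p)
  C[M+p,p]-pairing M = begin
    ((M + p) C p) * (∏ℕ (λ i → suc i * mirror i) h * p)      ≡⟨ cong (λ n → ((M + p) C p) * (n * p)) (trans (∏ℕ-mirror suc h)
                                                                     (∏ℕ-cong h (λ i i<h → cong (suc i *_) (1+[2h∸[1+i]]≡mirror i<h)))) ⟨
    ((M + p) C p) * ∏ℕ suc p                                 ≡⟨ cong (((M + p) C p) *_) (n!≡∏ p) ⟨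
    ((M + p) C p) * p !                                      ≡⟨ [m+k]Ck*k!≡∏ M p ⟩
    ∏ℕ (λ t → M + suc t) (h + h) * (M + p)                   ≡⟨ cong (_* (M + p)) (trans (∏ℕ-mirror (λ t → M + suc t) h)
                                                                     (∏ℕ-cong h (λ i i<h → pair i (1+[2h∸[1+i]]≡mirror i<h) (1+i+mirror≡p i<h)))) ⟩
    ∏ℕ (λ i → suc i * mirror i + M * (M + p)) h * (M + p)    ∎
    where
    open ≡-Reasoning
    pair : ∀ i {j} → suc (h + h ∸ suc i) ≡ j → suc i + j ≡ p →
           (M + suc i) * (M + suc (h + h ∸ suc i)) ≡ suc i * j + M * (M + p)
    pair i {j} eq sum rewrite eq | sym sum =
      solve 3 (λ M t s → (M :+ t) :* (M :+ s) := t :* s :+ M :* (M :+ (t :+ s))) refl M (suc i) j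
      where open ℕ-Solver

  [1+i]*mirror*z≡1 : ∀ {i} → i < h → ℕ→ℚ (suc i * mirror i) *ℚ z i ≡ 1ℚ
  [1+i]*mirror*z≡1 {i} i<h = begin
    ℕ→ℚ (suc i * mirror i) *ℚ (u *ℚ v)       ≡⟨ cong (_*ℚ (u *ℚ v)) (ℕ→ℚ-* (suc i) (mirror i)) ⟩
    T *ℚ S *ℚ (u *ℚ v)                        ≡⟨ solve 4 (λ T S u v → T :* S :* (u :* v) := (T :* u) :* (S :* v)) refl T S u v ⟩
    (T *ℚ u) *ℚ (S *ℚ v)                      ≡⟨ cong₂ _*ℚ_ (ℕ→ℚ*1/ℕ≡1 {suc i} (s≤s z≤n)) (ℕ→ℚ*1/ℕ≡1 (0<mirror i<h)) ⟩
    1ℚ *ℚ 1ℚ                                  ∎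
    where open ≡-Reasoning
          open ℚ-Solver
          T = ℕ→ℚ (suc i)
          S = ℕ→ℚ (mirror i)
          u = 1/ℕ (suc i)
          v = 1/ℕ (mirror i)

  C[mp+p,p]≡ : ∀ m → ℕ→ℚ ((m * p + p) C p) ≡ ℕ→ℚ (suc m) *ℚ G (m * suc m)
  C[mp+p,p]≡ m = *-cancelʳ-invertible A*∏z≡1 (begin
    ℕ→ℚ Cn *ℚ A                          ≡⟨ cong (ℕ→ℚ Cn *ℚ_) (ℕ→ℚ-∏ℕ a h) ⟨
    ℕ→ℚ Cn *ℚ ℕ→ℚ (∏ℕ a h)               ≡⟨ ℕ→ℚ-* Cn (∏ℕ a h) ⟨
    ℕ→ℚ (Cn * ∏ℕ a h)                    ≡⟨ cong ℕ→ℚ C*∏a≡[1+m]*∏b ⟩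
    ℕ→ℚ (suc m * ∏ℕ b h)                 ≡⟨ trans (ℕ→ℚ-* (suc m) (∏ℕ b h)) (cong (K *ℚ_) (ℕ→ℚ-∏ℕ b h)) ⟩
    K *ℚ ∏ (ℕ→ℚ ∘ b) h                   ≡⟨ cong (K *ℚ_) (trans (∏-cong h b≡a*[1+xz]) (∏-* (ℕ→ℚ ∘ a) _ h)) ⟩
    K *ℚ (A *ℚ G c)                        ≡⟨ cong (K *ℚ_) (ℚₚ.*-comm A (G c)) ⟩
    K *ℚ (G c *ℚ A)                        ≡⟨ ℚₚ.*-assoc K (G c) A ⟨
    K *ℚ G c *ℚ A                          ∎)
    where
    open ≡-Reasoning
    Cn = (m * p + p) C p
    a b : ℕ → ℕ
    a i = suc i * mirror i
    b i = a i + m * p * (m * p + p)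
    c = m * suc m
    K = ℕ→ℚ (suc m)
    A = ∏ (ℕ→ℚ ∘ a) h
    A*∏z≡1 : A *ℚ ∏ z h ≡ 1ℚ
    A*∏z≡1 = trans (sym (∏-* (ℕ→ℚ ∘ a) z h)) (∏-identity h (λ i i<h → [1+i]*mirror*z≡1 i<h))
    mp[mp+p]≡m[1+m]p² : m * p * (m * p + p) ≡ m * suc m * (p * p)
    mp[mp+p]≡m[1+m]p² = solve 2 (λ m p → m :* p :* (m :* p :+ p) := m :* (con 1 :+ m) :* (p :* p)) refl m p
      where open ℕ-Solver
    B[mp+p]≡[1+m]Bp : ∀ B → B * (m * p + p) ≡ suc m * B * p
    B[mp+p]≡[1+m]Bp B = solve 3 (λ B m p → B :* (m :* p :+ p) := (con 1 :+ m) :* B :* p) refl B m p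
      where open ℕ-Solver
    C*∏a≡[1+m]*∏b : Cn * ∏ℕ a h ≡ suc m * ∏ℕ b h
    C*∏a≡[1+m]*∏b = ℕₚ.*-cancelʳ-≡ _ _ p (begin
      Cn * ∏ℕ a h * p              ≡⟨ ℕₚ.*-assoc Cn (∏ℕ a h) p ⟩
      Cn * (∏ℕ a h * p)            ≡⟨ C[M+p,p]-pairing (m * p) ⟩
      ∏ℕ b h * (m * p + p)         ≡⟨ B[mp+p]≡[1+m]Bp (∏ℕ b h) ⟩
      suc m * ∏ℕ b h * p           ∎)
    b≡a*[1+xz] : ∀ i → i < h → ℕ→ℚ (b i) ≡ ℕ→ℚ (a i) *ℚ (1ℚ +ℚ x c *ℚ z i)
    b≡a*[1+xz] i i<h = begin
      ℕ→ℚ (a i + m * p * (m * p + p))                  ≡⟨ ℕ→ℚ-+ (a i) _ ⟩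
      ℕ→ℚ (a i) +ℚ ℕ→ℚ (m * p * (m * p + p))           ≡⟨ cong (λ n → ℕ→ℚ (a i) +ℚ ℕ→ℚ n) mp[mp+p]≡m[1+m]p² ⟩
      ℕ→ℚ (a i) +ℚ ℕ→ℚ (m * suc m * (p * p))           ≡⟨ cong (ℕ→ℚ (a i) +ℚ_) (trans (ℕ→ℚ-* (m * suc m) (p * p)) (cong (ℕ→ℚ (m * suc m) *ℚ_) (ℕ→ℚ-* p p))) ⟩
      ℕ→ℚ (a i) +ℚ x c                                 ≡⟨ cong (ℕ→ℚ (a i) +ℚ_) (trans (sym (ℚₚ.*-identityʳ (x c))) (cong (x c *ℚ_) (sym ([1+i]*mirror*z≡1 i<h)))) ⟩
      ℕ→ℚ (a i) +ℚ x c *ℚ (ℕ→ℚ (a i) *ℚ z i)             ≡⟨ solve 3 (λ A x z → A :+ x :* (A :* z) := A :* (con 1ℚ :+ x :* z)) refl (ℕ→ℚ (a i)) (x c) (z i) ⟩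
      ℕ→ℚ (a i) *ℚ (1ℚ +ℚ x c *ℚ z i)                    ∎
      where open ℚ-Solver

  1/ℕ+1/ℕ≡P*z : ∀ {i} → i < h → 1/ℕ (suc i) +ℚ 1/ℕ (mirror i) ≡ P *ℚ z i
  1/ℕ+1/ℕ≡P*z {i} i<h = trans (1/ℕ-+ {suc i} (s≤s z≤n) (0<mirror i<h)) (cong (λ n → ℕ→ℚ n *ℚ z i) (1+i+mirror≡p i<h))

  sumInvCube≡ : sumInvCube (p ∸ 1) ≡ P *ℚ P *ℚ P *ℚ Q₃ -ℚ ℕ→ℚ 3 *ℚ P *ℚ Q₂
  sumInvCube≡ = begin
    sumInvCube (h + h)                                                          ≡⟨ sumInvCube≡∑ (h + h) ⟩
    ∑ invCubeSuc (h + h)                                                        ≡⟨ ∑-mirror invCubeSuc h ⟩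
    ∑ (λ i → invCubeSuc i +ℚ invCubeSuc (h + h ∸ suc i)) h                      ≡⟨ ∑-cong h pair ⟩
    ∑ (λ i → P *ℚ P *ℚ P *ℚ (z i *ℚ z i *ℚ z i) -ℚ ℕ→ℚ 3 *ℚ P *ℚ (z i *ℚ z i)) h ≡⟨ ∑-sub _ _ h ⟩
    ∑ (λ i → P *ℚ P *ℚ P *ℚ (z i *ℚ z i *ℚ z i)) h -ℚ ∑ (λ i → ℕ→ℚ 3 *ℚ P *ℚ (z i *ℚ z i)) h
                                                                                ≡⟨ cong₂ _-ℚ_ (∑-*ˡ (P *ℚ P *ℚ P) _ h) (∑-*ˡ (ℕ→ℚ 3 *ℚ P) _ h) ⟩
    P *ℚ P *ℚ P *ℚ ∑ (λ i → z i *ℚ z i *ℚ z i) h -ℚ ℕ→ℚ 3 *ℚ P *ℚ ∑ (λ i → z i *ℚ z i) h ∎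
    where
    open ≡-Reasoning
    open ℚ-Solver
    pair : ∀ i → i < h → invCubeSuc i +ℚ invCubeSuc (h + h ∸ suc i)
                       ≡ P *ℚ P *ℚ P *ℚ (z i *ℚ z i *ℚ z i) -ℚ ℕ→ℚ 3 *ℚ P *ℚ (z i *ℚ z i)
    pair i i<h = begin
      invCubeSuc i +ℚ invCubeSuc (h + h ∸ suc i)                    ≡⟨ cong₂ _+ℚ_ (invCubeSuc≡1/ℕ³ i)
                                                                         (trans (invCubeSuc≡1/ℕ³ (h + h ∸ suc i)) (cong (λ n → 1/ℕ n *ℚ 1/ℕ n *ℚ 1/ℕ n) (1+[2h∸[1+i]]≡mirror i<h))) ⟩
      u *ℚ u *ℚ u +ℚ v *ℚ v *ℚ v                                    ≡⟨ solve 2 (λ u v → u :* u :* u :+ v :* v :* v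
                                                                         := (u :+ v) :* (u :+ v) :* (u :+ v) :- con (ℕ→ℚ 3) :* (u :* v) :* (u :+ v)) refl u v ⟩
      (u +ℚ v) *ℚ (u +ℚ v) *ℚ (u +ℚ v) -ℚ ℕ→ℚ 3 *ℚ z i *ℚ (u +ℚ v)  ≡⟨ cong (λ w → w *ℚ w *ℚ w -ℚ ℕ→ℚ 3 *ℚ z i *ℚ w) (1/ℕ+1/ℕ≡P*z i<h) ⟩
      Pz *ℚ Pz *ℚ Pz -ℚ ℕ→ℚ 3 *ℚ z i *ℚ Pz                          ≡⟨ solve 2 (λ P z → (P :* z) :* (P :* z) :* (P :* z) :- con (ℕ→ℚ 3) :* z :* (P :* z)
                                                                         := P :* P :* P :* (z :* z :* z) :- con (ℕ→ℚ 3) :* P :* (z :* z)) refl P (z i) ⟩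
      P *ℚ P *ℚ P *ℚ (z i *ℚ z i *ℚ z i) -ℚ ℕ→ℚ 3 *ℚ P *ℚ (z i *ℚ z i) ∎
      where u = 1/ℕ (suc i)
            v = 1/ℕ (mirror i)
            Pz = P *ℚ z i

  lhs rhs : ℚ
  lhs = ℕ→ℚ 12 -ℚ ℕ→ℚ (9 * ((2 * p) C p)) +ℚ ℕ→ℚ (2 * ((3 * p) C p))
  rhs = ℕ→ℚ (24 * p ^ 3) *ℚ sumInvCube (p ∸ 1)

  ℕ→ℚ-p^3 : ℕ→ℚ (p ^ 3) ≡ P *ℚ (P *ℚ (P *ℚ 1ℚ))
  ℕ→ℚ-p^3 = trans (ℕ→ℚ-* p (p ^ 2)) (cong (P *ℚ_) (trans (ℕ→ℚ-* p (p ^ 1)) (cong (P *ℚ_) (ℕ→ℚ-* p 1))))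

  lhs-rhs≡ : lhs -ℚ rhs
           ≡ ℕ→ℚ 6 *ℚ (G 6 -ℚ E 6) -ℚ ℕ→ℚ 18 *ℚ (G 2 -ℚ E 2)
             +ℚ ℕ→ℚ 72 *ℚ (P *ℚ (P *ℚ (P *ℚ (P *ℚ (∑ z h *ℚ ∑ z h)))))
             -ℚ ℕ→ℚ 24 *ℚ (P *ℚ (P *ℚ (P *ℚ (P *ℚ (P *ℚ (P *ℚ Q₃))))))
  lhs-rhs≡ = begin
    lhs -ℚ rhs
      ≡⟨ cong₂ _-ℚ_ (cong₂ (λ a b → ℕ→ℚ 12 -ℚ a +ℚ b) (C[kp,p]≡ 9 1) (C[kp,p]≡ 2 2))
                    (cong₂ _*ℚ_ (trans (ℕ→ℚ-* 24 (p ^ 3)) (cong (ℕ→ℚ 24 *ℚ_) ℕ→ℚ-p^3)) sumInvCube≡) ⟩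
    ℕ→ℚ 12 -ℚ ℕ→ℚ 9 *ℚ (ℕ→ℚ 2 *ℚ G 2) +ℚ ℕ→ℚ 2 *ℚ (ℕ→ℚ 3 *ℚ G 6)
      -ℚ ℕ→ℚ 24 *ℚ (P *ℚ (P *ℚ (P *ℚ 1ℚ))) *ℚ (P *ℚ P *ℚ P *ℚ Q₃ -ℚ ℕ→ℚ 3 *ℚ P *ℚ Q₂)
      ≡⟨ solve 7 (λ G₂ G₆ Z e Q₂ Q₃ P →
           con (ℕ→ℚ 12) :- con (ℕ→ℚ 9) :* (con (ℕ→ℚ 2) :* G₂) :+ con (ℕ→ℚ 2) :* (con (ℕ→ℚ 3) :* G₆)
             :- con (ℕ→ℚ 24) :* (P :* (P :* (P :* con 1ℚ))) :* (P :* P :* P :* Q₃ :- con (ℕ→ℚ 3) :* P :* Q₂)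
           := con (ℕ→ℚ 6) :* (G₆ :- (con 1ℚ :+ con (ℕ→ℚ 6) :* (P :* P) :* Z :+ con (ℕ→ℚ 6) :* (P :* P) :* (con (ℕ→ℚ 6) :* (P :* P)) :* e))
             :- con (ℕ→ℚ 18) :* (G₂ :- (con 1ℚ :+ con (ℕ→ℚ 2) :* (P :* P) :* Z :+ con (ℕ→ℚ 2) :* (P :* P) :* (con (ℕ→ℚ 2) :* (P :* P)) :* e))
             :+ con (ℕ→ℚ 72) :* (P :* (P :* (P :* (P :* (con (ℕ→ℚ 2) :* e :+ Q₂)))))
             :- con (ℕ→ℚ 24) :* (P :* (P :* (P :* (P :* (P :* (P :* Q₃)))))))
         refl (G 2) (G 6) (∑ z h) (e₂ z h) Q₂ Q₃ P ⟩
    ℕ→ℚ 6 *ℚ (G 6 -ℚ E 6) -ℚ ℕ→ℚ 18 *ℚ (G 2 -ℚ E 2)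
      +ℚ ℕ→ℚ 72 *ℚ (P *ℚ (P *ℚ (P *ℚ (P *ℚ (ℕ→ℚ 2 *ℚ e₂ z h +ℚ Q₂)))))
      -ℚ ℕ→ℚ 24 *ℚ (P *ℚ (P *ℚ (P *ℚ (P *ℚ (P *ℚ (P *ℚ Q₃))))))
      ≡⟨ cong (λ w → ℕ→ℚ 6 *ℚ (G 6 -ℚ E 6) -ℚ ℕ→ℚ 18 *ℚ (G 2 -ℚ E 2) +ℚ ℕ→ℚ 72 *ℚ (P *ℚ (P *ℚ (P *ℚ (P *ℚ w))))
                     -ℚ ℕ→ℚ 24 *ℚ (P *ℚ (P *ℚ (P *ℚ (P *ℚ (P *ℚ (P *ℚ Q₃)))))))
              (trans (cong (_+ℚ Q₂) (2*e₂≡∑²-∑sq z h)) (solve 2 (λ Z Q → Z :- Q :+ Q := Z) refl (∑ z h *ℚ ∑ z h) Q₂)) ⟩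
    ℕ→ℚ 6 *ℚ (G 6 -ℚ E 6) -ℚ ℕ→ℚ 18 *ℚ (G 2 -ℚ E 2)
      +ℚ ℕ→ℚ 72 *ℚ (P *ℚ (P *ℚ (P *ℚ (P *ℚ (∑ z h *ℚ ∑ z h)))))
      -ℚ ℕ→ℚ 24 *ℚ (P *ℚ (P *ℚ (P *ℚ (P *ℚ (P *ℚ (P *ℚ Q₃))))))   ∎
    where
    open ≡-Reasoning
    open ℚ-Solver
    C[kp,p]≡ : ∀ a m → ℕ→ℚ (a * ((suc m * p) C p)) ≡ ℕ→ℚ a *ℚ (ℕ→ℚ (suc m) *ℚ G (m * suc m))
    C[kp,p]≡ a m = trans (ℕ→ℚ-* a _) (cong (ℕ→ℚ a *ℚ_) (trans (cong (λ n → ℕ→ℚ (n C p)) (ℕₚ.+-comm p (m * p))) (C[mp+p,p]≡ m)))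

module OddPrime (h : ℕ) (p-prime : Prime (suc (h + h))) (2≤h : 2 ≤ h) where

  open OddPairing h
  open Valuation p p-prime
  open ℚ-Solver

  0≤ᵥz : ∀ {i} → i < h → 0 ≤ᵥ z i
  0≤ᵥz {i} i<h = 0≤ᵥ1/ts {suc i} (s≤s z≤n) (0<mirror i<h) (1+i+mirror≡p i<h)

  4<p : 4 < p
  4<p = s≤s (ℕₚ.+-mono-≤ 2≤h 2≤h)

  p∤6 : ¬ p ∣ 6
  p∤6 p∣2*3 with euclidsLemma 2 3 p-prime p∣2*3
  ... | inj₁ p∣2 = p∤0<n<p (s≤s z≤n) (ℕₚ.<⇒≤ (ℕₚ.<⇒≤ 4<p)) p∣2
  ... | inj₂ p∣3 = p∤0<n<p (s≤s z≤n) (ℕₚ.<⇒≤ 4<p) p∣3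

  private
    1/² : ℕ → ℚ
    1/² n = 1/ℕ n *ℚ 1/ℕ n

  -- Pairing n with p - n shows All ≡ 2T, and pairing odd n with even p - n shows Odd ≡ Even;
  -- as T = 4 Even, this gives 6 Even ≡ 0, and p ∤ 6.
  1≤ᵥ∑1/² : 1 ≤ᵥ ∑ (λ i → 1/² (suc i)) h
  1≤ᵥ∑1/² = ≤ᵥ-resp-≡ (sym T≡4*Even) (≤ᵥ-* (0≤ᵥℕ 4) 1≤ᵥEven)
    where
    T Even Odd All : ℚ
    T = ∑ (λ i → 1/² (suc i)) h
    Even = ∑ (λ i → 1/² (suc (suc (i + i)))) h
    Odd = ∑ (λ i → 1/² (suc (i + i))) h
    All = ∑ (λ j → 1/² (suc j)) (h + h)

    All≡Odd+Even : All ≡ Odd +ℚ Even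
    All≡Odd+Even = trans (∑-evenOdd _ h) (∑-+ _ _ h)

    T≡4*Even : T ≡ ℕ→ℚ 4 *ℚ Even
    T≡4*Even = trans (∑-cong h (λ i _ → trans (1/ℕ²≡4*1/ℕ[n+n]² {suc i} (s≤s z≤n))
                   (cong (λ n → ℕ→ℚ 4 *ℚ 1/² (suc n)) (ℕₚ.+-suc i i))))
                 (∑-*ˡ (ℕ→ℚ 4) _ h)

    1≤ᵥAll-2T : 1 ≤ᵥ All -ℚ (T +ℚ T)
    1≤ᵥAll-2T = ≤ᵥ-resp-≡ (cong₂ _-ℚ_ (sym All≡∑pairs) (∑-+ _ _ h))
      (≤ᵥ-∑-sub _ _ h (λ i i<h → ≤ᵥ-resp-≡
        (solve 2 (λ u v → v :- u := (u :+ v) :- (u :+ u)) refl (1/² (suc i)) (1/² (mirror i)))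
        (1≤ᵥ1/s²-1/t² (s≤s z≤n) (0<mirror i<h) (1+i+mirror≡p i<h))))
      where All≡∑pairs : All ≡ ∑ (λ i → 1/² (suc i) +ℚ 1/² (mirror i)) h
            All≡∑pairs = trans (∑-mirror _ h) (∑-cong h (λ i i<h → cong (λ n → 1/² (suc i) +ℚ 1/² n) (1+[2h∸[1+i]]≡mirror i<h)))

    1≤ᵥOdd-Even : 1 ≤ᵥ Odd -ℚ Even
    1≤ᵥOdd-Even = ≤ᵥ-resp-≡ (cong (_-ℚ Even) (sym Odd≡∑mirror))
      (≤ᵥ-∑-sub _ _ h (λ i i<h → 1≤ᵥ1/s²-1/t² (s≤s z≤n) (ℕₚ.m<n⇒0<n∸m (2i+2<p i<h)) (ℕₚ.m+[n∸m]≡n (ℕₚ.<⇒≤ (2i+2<p i<h)))))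
      where Odd≡∑mirror : Odd ≡ ∑ (λ i → 1/² (p ∸ suc (suc (i + i)))) h
            Odd≡∑mirror = trans (∑-reverse _ h) (∑-cong h (λ i i<h → cong 1/² (1+2[h∸[1+i]]≡p∸[2i+2] i<h)))

    1≤ᵥEven : 1 ≤ᵥ Even
    1≤ᵥEven = ≤ᵥ-cancel-unit 6 p∤6 (≤ᵥ-resp-≡ 6*Even (≤ᵥ-sub 1≤ᵥOdd-Even 1≤ᵥAll-2T))
      where 6*Even : Odd -ℚ Even -ℚ (All -ℚ (T +ℚ T)) ≡ ℕ→ℚ 6 *ℚ Even
            6*Even = trans (cong₂ (λ a t → Odd -ℚ Even -ℚ (a -ℚ (t +ℚ t))) All≡Odd+Even T≡4*Even)
              (solve 2 (λ O E → O :- E :- ((O :+ E) :- (con (ℕ→ℚ 4) :* E :+ con (ℕ→ℚ 4) :* E)) := con (ℕ→ℚ 6) :* E) refl Odd Even)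

  1≤ᵥ∑z : 1 ≤ᵥ ∑ z h
  1≤ᵥ∑z = ≤ᵥ-resp-≡ (solve 2 (λ Z T → Z :+ T :- T := Z) refl (∑ z h) (∑ (λ i → 1/² (suc i)) h))
    (≤ᵥ-sub (≤ᵥ-resp-≡ (∑-+ z _ h) (≤ᵥ-∑ _ h (λ i i<h → 1≤ᵥ1/ts+1/t² {suc i} (s≤s z≤n) (0<mirror i<h) (1+i+mirror≡p i<h))))
          1≤ᵥ∑1/²)

  6≤ᵥG-E : ∀ c → 6 ≤ᵥ G c -ℚ E c
  6≤ᵥG-E c = ∏[1+x*z]-expansion z h (≤ᵥ-* (0≤ᵥℕ c) (≤ᵥ-* 1≤ᵥp 1≤ᵥp)) (λ i → 0≤ᵥz)

  congruence : 6 ≤ᵥ lhs -ℚ rhs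
  congruence = ≤ᵥ-resp-≡ (sym lhs-rhs≡)
    (≤ᵥ-sub (≤ᵥ-+ (≤ᵥ-sub (≤ᵥ-* (0≤ᵥℕ 6) (6≤ᵥG-E 6)) (≤ᵥ-* (0≤ᵥℕ 18) (6≤ᵥG-E 2)))
                (≤ᵥ-* (0≤ᵥℕ 72) (p* (p* (p* (p* (≤ᵥ-* 1≤ᵥ∑z 1≤ᵥ∑z)))))))
          (≤ᵥ-* (0≤ᵥℕ 24) (p* (p* (p* (p* (p* (p* (≤ᵥ-∑ _ h (λ i i<h → ≤ᵥ-* (≤ᵥ-* (0≤ᵥz i<h) (0≤ᵥz i<h)) (0≤ᵥz i<h)))))))))))
    where p* : ∀ {k q} → k ≤ᵥ q → suc k ≤ᵥ P *ℚ q
          p* = ≤ᵥ-* 1≤ᵥp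

mainTheorem1 : ∀ (p : ℕ) → Prime p → p % 2 ≡ 1 →
    (ℕ→ℚ 12 -ℚ ℕ→ℚ (9 * ((2 * p) C p)) +ℚ ℕ→ℚ (2 * ((3 * p) C p)))
    ≡ ℕ→ℚ (24 * p ^ 3) *ℚ sumInvCube (p ∸ 1) [modℚ p ^ 6 ]
mainTheorem1 p p-prime p%2≡1 = subst Congruence (sym p≡1+2h) (odd h (subst Prime p≡1+2h p-prime))
  where
  Congruence : ℕ → Set
  Congruence p = (ℕ→ℚ 12 -ℚ ℕ→ℚ (9 * ((2 * p) C p)) +ℚ ℕ→ℚ (2 * ((3 * p) C p)))
                 ≡ ℕ→ℚ (24 * p ^ 3) *ℚ sumInvCube (p ∸ 1) [modℚ p ^ 6 ]

  h = p / 2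

  p≡1+2h : p ≡ suc (h + h)
  p≡1+2h = trans (m≡m%n+[m/n]*n p 2)
    (cong₂ _+_ p%2≡1 (trans (ℕₚ.*-comm h 2) (cong (λ n → h + n) (ℕₚ.+-identityʳ h))))

  odd : ∀ h → Prime (suc (h + h)) → Congruence (suc (h + h))
  odd zero          1-prime = ⊥-elim (¬prime[1] 1-prime)
  -- p = 3: the left side is 12 - 9·20 + 2·84 = 0 and the right side 24·27·(1 + 1/8) = 3⁶.
  odd (suc zero)    _       = divides 1 refl
  odd (suc (suc h)) p-prime = Valuation.≤ᵥ⇒p^k∣↥ _ p-prime (OddPrime.congruence (suc (suc h)) p-prime (s≤s (s≤s z≤n)))
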